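{- Let $n\in\mathbb{N}$ and let $N_n$ denote the number of different $n\times n$ principal reversible squares. Then $N_n=1$ if and only if $n$ is prime.
   Context: $\mathbb{N}=\{1,2,3,\dots\}$. A reversible square matrix is an $n\times n$ real matrix $M=(M_{i,j})_{i,j\in\mathbb{Z}_n}$, indices taken in $\mathbb{Z}_n=\mathbb{Z}/n\mathbb{Z}$ with the top left entry having index $(1,1)$, such that (R) $M_{i,j}+M_{i,n+1-j}=M_{i,k}+M_{i,n+1-k}$ and $M_{i,j}+M_{n+1-i,j}=M_{k,j}+M_{n+1-k,j}$ for all $i,j,k\in\mathbb{Z}_n$, and (V) $M_{i,j}+M_{k,l}=M_{i,l}+M_{k,j}$ for all $i,j,k,l\in\mathbb{Z}_n$. An $n\times n$ principal reversible square is a reversible square matrix $M$ with $\{M_{i,j}\}=\{1,2,\dots,n^2\}$, whose entries in each row and in each column appear in increasing order, and with $M_{1,1}=1$, $M_{1,2}=2$. -}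

module Defs where

open import Data.Nat using (ℕ; _+_; _*_; _≤_; _<_; NonZero)
open import Data.Nat.DivMod using (_mod_)
open import Data.Fin as Fin using (Fin; opposite)
open import Data.Product using (_×_; ∃₂; Σ)
open import Relation.Binary.PropositionalEquality using (_≡_)

-- Index i : Fin n is the
-- 0-based representative of the paper's 1-based index (i+1) ∈ ℤ_n.
-- The paper's index n+1-j corresponds (0-based) to n-1-j = opposite j.
Matrix : ℕ → Set
Matrix n = Fin n → Fin n → ℕ

IsR : ∀ {n} → Matrix n → Set
IsR {n} M =
  (∀ (i j k : Fin n) → M i j + M i (opposite j) ≡ M i k + M i (opposite k))
  × (∀ (i j k : Fin n) → M i j + M (opposite i) j ≡ M k j + M (opposite k) j)

IsV : ∀ {n} → Matrix n → Set
IsV {n} M = ∀ (i j k l : Fin n) → M i j + M k l ≡ M i l + M k j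

IsReversible : ∀ {n} → Matrix n → Set
IsReversible M = IsR M × IsV M

EntriesAre1toN² : ∀ {n} → Matrix n → Set
EntriesAre1toN² {n} M =
  (∀ (i j : Fin n) → 1 ≤ M i j × M i j ≤ n * n)
  × (∀ (m : ℕ) → 1 ≤ m → m ≤ n * n → ∃₂ λ i j → M i j ≡ m)

Increasing : ∀ {n} → Matrix n → Set
Increasing {n} M =
  (∀ (i j k : Fin n) → j Fin.< k → M i j < M i k)
  × (∀ (i j k : Fin n) → i Fin.< k → M i j < M k j)

-- principal reversible square; paper's M_{1,1} and M_{1,2} are
-- (0-based) M 0 0 and M 0 (1 mod n), indices taken in ℤ_n
IsPrincipalReversibleSquare : (n : ℕ) .{{_ : NonZero n}} → Matrix n → Set
IsPrincipalReversibleSquare n M =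
  IsReversible M × EntriesAre1toN² M × Increasing M
  × (M (0 mod n) (0 mod n) ≡ 1) × (M (0 mod n) (1 mod n) ≡ 2)

-- N_n = 1: there is exactly one principal reversible square
-- (matrices compared entrywise)
UniquePRS : (n : ℕ) .{{_ : NonZero n}} → Set
UniquePRS n =
  Σ (Matrix n) (λ M → IsPrincipalReversibleSquare n M
    × (∀ M′ → IsPrincipalReversibleSquare n M′ → ∀ i j → M′ i j ≡ M i j))

{-# OPTIONS --safe #-}
-- Condition (V) makes every principal reversible square of size n a sum M p q = 1 + X p + Y q of its
-- first column and first row, and since the n² entries are 1, …, n², every v < n² is X i + Y j in
-- exactly one way.  Let k = X 1.  The first row starts 0, 1, …, k - 1, and strong induction on v
-- shows that the X-values are multiples of k and that the set of Y-values is a union of whole blocks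
-- [q k, q k + k).  If k < n this gives Y j ≡ j (mod k) and, as the last Y-value ends a block, k ∣ n.
-- So for prime n we get k ≥ n, whence X i = n i and Y j = j: the square is the standard one.
-- Conversely a factorisation n = d e with 1 < d < n yields a second square, whose rows step by d
-- and whose columns come in e runs of d consecutive values, the runs d n apart.
module Submission where

open import Defs
open import Data.Nat
open import Data.Nat.Properties
open import Data.Nat.DivMod
open import Data.Nat.Divisibility
open import Data.Nat.Induction using (<-rec)
open import Data.Nat.Primality
open import Data.Nat.Tactic.RingSolver using (solve-∀)
open import Data.Fin as Fin using (Fin; toℕ; fromℕ<; opposite; combine; remQuot; punchOut)
open import Data.Fin.Properties
  using (toℕ-injective; toℕ-fromℕ<; toℕ<n; opposite-prop; injective⇒≤; punchOut-injective;
         remQuot-combine; combine-injective)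
open import Data.Product
open import Data.Sum using (_⊎_; inj₁; inj₂)
open import Data.Empty using (⊥; ⊥-elim)
open import Function using (_∘_)
open import Function.Bundles using (_⇔_; mk⇔; Equivalence)
open import Function.Definitions using (Injective)
open import Relation.Nullary using (¬_; yes; no; contradiction)
open import Relation.Binary.PropositionalEquality

surjective⇒injective : ∀ {N} {f : Fin N → Fin N} →
                       (∀ y → ∃ λ x → f x ≡ y) → Injective _≡_ _≡_ f
surjective⇒injective {zero} _ {()}
surjective⇒injective {suc N} {f} surj {a} {b} fa≡fb with a Fin.≟ b
... | yes a≡b = a≡b
... | no a≢b = contradiction (injective⇒≤ punchOut∘g-injective) (n≮n N)
  where
  g : Fin (suc N) → Fin (suc N)
  g y = proj₁ (surj y)

  g-injective : Injective _≡_ _≡_ g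
  g-injective {y} {y′} gy≡gy′ =
    trans (sym (proj₂ (surj y))) (trans (cong f gy≡gy′) (proj₂ (surj y′)))

  -- g y ∈ {a, b} forces y ≡ f a, so g misses a or b
  missed : ∃ λ c → ∀ y → c ≢ g y
  missed with g (f a) Fin.≟ a
  ... | yes gfa≡a = b , λ y b≡gy → a≢b (trans (sym gfa≡a)
          (trans (cong g (trans fa≡fb (trans (cong f b≡gy) (proj₂ (surj y))))) (sym b≡gy)))
  ... | no gfa≢a = a , λ y a≡gy → gfa≢a (trans (cong g (trans (cong f a≡gy) (proj₂ (surj y)))) (sym a≡gy))

  punchOut∘g-injective : Injective _≡_ _≡_ (λ y → punchOut (proj₂ missed y))
  punchOut∘g-injective = g-injective ∘ punchOut-injective (proj₂ missed _) (proj₂ missed _)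

toℕ-mod : ∀ {i n} .{{_ : NonZero n}} → i < n → toℕ (i mod n) ≡ i
toℕ-mod {i} {n} i<n = trans (toℕ-fromℕ< (m%n<n i n)) (m<n⇒m%n≡m i<n)

%-suc-cong : ∀ a b k .{{_ : NonZero k}} → a % k ≡ b % k → suc a % k ≡ suc b % k
%-suc-cong a b k a≡b = begin
  suc a % k             ≡⟨ %-distribˡ-+ 1 a k ⟩
  (1 % k + a % k) % k   ≡⟨ cong (λ r → (1 % k + r) % k) a≡b ⟩
  (1 % k + b % k) % k   ≡⟨ %-distribˡ-+ 1 b k ⟨
  suc b % k             ∎
  where open ≡-Reasoning

record IsSumTiling (n : ℕ) (X Y : ℕ → ℕ) : Set where
  field
    X-zero         : X 0 ≡ 0
    Y-zero         : Y 0 ≡ 0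
    X-strictMono   : ∀ {i j} → i < j → j < n → X i < X j
    Y-strictMono   : ∀ {i j} → i < j → j < n → Y i < Y j
    sum-injectiveˡ : ∀ {i j i′ j′} → i < n → j < n → i′ < n → j′ < n →
                     X i + Y j ≡ X i′ + Y j′ → i ≡ i′
    sum-surjective : ∀ {v} → v < n * n → ∃₂ λ i j → i < n × j < n × X i + Y j ≡ v
    sum-bounded    : ∀ {i j} → i < n → j < n → X i + Y j < n * n

module SumTiling {n : ℕ} {X Y : ℕ → ℕ} (T : IsSumTiling n X Y) where
  open IsSumTiling T

  infix 4 _∈Y

  _∈Y : ℕ → Set
  v ∈Y = ∃ λ j → j < n × Y j ≡ v

  private
    n>0 : ∀ {i} → i < n → 0 < n
    n>0 = ≤-<-trans z≤n

    <n⇒<n*n : ∀ {v} → v < n → v < n * n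
    <n⇒<n*n v<n = <-≤-trans v<n (m≤m*n n n {{>-nonZero (n>0 v<n)}})

  X-mono-≤ : ∀ {i j} → i ≤ j → j < n → X i ≤ X j
  X-mono-≤ i≤j j<n with m≤n⇒m<n∨m≡n i≤j
  ... | inj₁ i<j  = <⇒≤ (X-strictMono i<j j<n)
  ... | inj₂ refl = ≤-refl

  Y-mono-≤ : ∀ {i j} → i ≤ j → j < n → Y i ≤ Y j
  Y-mono-≤ i≤j j<n with m≤n⇒m<n∨m≡n i≤j
  ... | inj₁ i<j  = <⇒≤ (Y-strictMono i<j j<n)
  ... | inj₂ refl = ≤-refl

  Y-cancel-< : ∀ {i j} → i < n → Y i < Y j → i < j
  Y-cancel-< {i} {j} i<n Yi<Yj with i <? j
  ... | yes i<j = i<j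
  ... | no  i≮j = contradiction (Y-mono-≤ (≮⇒≥ i≮j) i<n) (<⇒≱ Yi<Yj)

  Y-bounded : ∀ {j} → j < n → Y j < n * n
  Y-bounded {j} j<n = subst (_< n * n) (cong (_+ Y j) X-zero) (sum-bounded (n>0 j<n) j<n)

  ∈Y⊎positive-sum : ∀ {v} → v < n * n →
                    v ∈Y ⊎ ∃₂ λ i j → 0 < i × i < n × j < n × X i + Y j ≡ v
  ∈Y⊎positive-sum v<n*n with sum-surjective v<n*n
  ... | zero  , j , _   , j<n , e = inj₁ (j , j<n , trans (cong (_+ Y j) (sym X-zero)) e)
  ... | suc i , j , i<n , j<n , e = inj₂ (suc i , j , z<s , i<n , j<n , e)

  X+∈Y⇒zero : ∀ {i v} → i < n → v ∈Y → (X i + v) ∈Y → i ≡ 0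
  X+∈Y⇒zero {i} i<n (j , j<n , Yj≡v) (j′ , j′<n , Yj′≡X+v) = sum-injectiveˡ i<n j<n (n>0 i<n) j′<n (begin
    X i + Y j   ≡⟨ cong (X i +_) Yj≡v ⟩
    X i + _     ≡⟨ Yj′≡X+v ⟨
    Y j′        ≡⟨ cong (_+ Y j′) X-zero ⟨
    X 0 + Y j′  ∎)
    where open ≡-Reasoning

  k : ℕ
  k = X 1

  k≤X : ∀ {i} → 0 < i → i < n → k ≤ X i
  k≤X = X-mono-≤

  below-k⇒∈Y : ∀ {v} → v < k → v < n * n → v ∈Y
  below-k⇒∈Y v<k v<n*n with ∈Y⊎positive-sum v<n*n
  ... | inj₁ v∈Y = v∈Y
  ... | inj₂ (i , j , 0<i , i<n , _ , e) =
    contradiction (≤-trans (k≤X 0<i i<n) (subst (X i ≤_) e (m≤m+n (X i) (Y j)))) (<⇒≱ v<k)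

  Y-identity-below : ∀ {d} → d < k → d < n → Y d ≡ d
  Y-identity-below {zero} _ _ = Y-zero
  Y-identity-below {suc d} d+1<k d+1<n with below-k⇒∈Y d+1<k (<n⇒<n*n d+1<n)
  ... | m , m<n , Ym≡d+1 = ≤-antisym (subst (Y (suc d) ≤_) Ym≡d+1 (Y-mono-≤ d<m m<n)) d<Y[d+1]
    where
    Yd≡d : Y d ≡ d
    Yd≡d = Y-identity-below (<-trans (n<1+n d) d+1<k) (<-trans (n<1+n d) d+1<n)

    d<m : d < m
    d<m = Y-cancel-< (<-trans (n<1+n d) d+1<n) (subst₂ _<_ (sym Yd≡d) (sym Ym≡d+1) (n<1+n d))

    d<Y[d+1] : d < Y (suc d)
    d<Y[d+1] = subst (_< Y (suc d)) Yd≡d (Y-strictMono (n<1+n d) d+1<n)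

  Y-identity : n ≤ k → ∀ {j} → j < n → Y j ≡ j
  Y-identity n≤k j<n = Y-identity-below (<-≤-trans j<n n≤k) j<n

  X-linear : n ≤ k → ∀ {i} → i < n → X i ≡ n * i
  X-linear n≤k {zero}  _     = trans X-zero (sym (*-zeroʳ n))
  X-linear n≤k {suc i} i+1<n = ≤-antisym upper lower
    where
    open ≤-Reasoning
    i<n : i < n
    i<n = <-trans (n<1+n i) i+1<n

    Xi≡ni : X i ≡ n * i
    Xi≡ni = X-linear n≤k i<n

    -- X (i + 1) + Y 0 would otherwise collide with X i + Y c for c = X (i + 1) ∸ X i < n
    lower : n * suc i ≤ X (suc i)
    lower = ≮⇒≥ λ X[i+1]<n[i+1] → contradiction
      (sum-injectiveˡ i+1<n (n>0 i<n) i<n (c<n X[i+1]<n[i+1]) (collision X[i+1]<n[i+1])) 1+n≢n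
      where
      c : ℕ
      c = X (suc i) ∸ X i

      Xi+c≡X[i+1] : X i + c ≡ X (suc i)
      Xi+c≡X[i+1] = m+[n∸m]≡n (<⇒≤ (X-strictMono (n<1+n i) i+1<n))

      c<n : X (suc i) < n * suc i → c < n
      c<n lt = +-cancelˡ-< (X i) c n (begin-strict
        X i + c      ≡⟨ Xi+c≡X[i+1] ⟩
        X (suc i)    <⟨ lt ⟩
        n * suc i    ≡⟨ *-suc n i ⟩
        n + n * i    ≡⟨ +-comm n (n * i) ⟩
        n * i + n    ≡⟨ cong (_+ n) Xi≡ni ⟨
        X i + n      ∎)

      collision : X (suc i) < n * suc i → X (suc i) + Y 0 ≡ X i + Y c
      collision X[i+1]<n[i+1] = begin-equality
        X (suc i) + Y 0  ≡⟨ cong (X (suc i) +_) Y-zero ⟩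
        X (suc i) + 0    ≡⟨ +-identityʳ _ ⟩
        X (suc i)        ≡⟨ Xi+c≡X[i+1] ⟨
        X i + c          ≡⟨ cong (X i +_) (Y-identity n≤k (c<n X[i+1]<n[i+1])) ⟨
        X i + Y c        ∎

    upper : X (suc i) ≤ n * suc i
    upper with sum-surjective (*-monoʳ-< n {{>-nonZero (n>0 i<n)}} i+1<n)
    ... | a , b , a<n , b<n , e with suc i ≤? a
    ...   | yes i<a = ≤-trans (X-mono-≤ i<a a<n) (subst (X a ≤_) e (m≤m+n (X a) (Y b)))
    ...   | no  i≮a = contradiction (begin-strict
      n * suc i  ≡⟨ e ⟨
      X a + Y b  ≡⟨ cong (X a +_) (Y-identity n≤k b<n) ⟩
      X a + b    ≤⟨ +-monoˡ-≤ b (subst (X a ≤_) Xi≡ni (X-mono-≤ (≮⇒≥ i≮a) i<n)) ⟩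
      n * i + b  <⟨ +-monoʳ-< (n * i) b<n ⟩
      n * i + n  ≡⟨ +-comm (n * i) n ⟩
      n + n * i  ≡⟨ *-suc n i ⟨
      n * suc i  ∎) (<-irrefl refl)

  module _ (1<n : 1 < n) (k<n : k < n) where
    private
      0<k : 0 < k
      0<k = subst (_< k) X-zero (X-strictMono z<s 1<n)

      instance
        k≢0 : NonZero k
        k≢0 = >-nonZero 0<k

      1≤X : ∀ {i} → 0 < i → i < n → 1 ≤ X i
      1≤X 0<i i<n = ≤-trans 0<k (k≤X 0<i i<n)

    -- X i + Y (k - 1) = (w + 1) + (k - 1) = X 1 + w forces i = 1
    X-after-Y⇒k : ∀ {w i} → w ∈Y → i < n → X i ≡ suc w → suc w ≡ k
    X-after-Y⇒k {w} {i} (m , m<n , Ym≡w) i<n Xi≡w+1 = trans (sym Xi≡w+1) (cong X i≡1)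
      where
      open ≡-Reasoning
      k-1<k : pred k < k
      k-1<k = ≤-reflexive (suc-pred k)

      i≡1 : i ≡ 1
      i≡1 = sum-injectiveˡ i<n (<-trans k-1<k k<n) 1<n m<n (begin
        X i + Y (pred k)  ≡⟨ cong₂ _+_ Xi≡w+1 (Y-identity-below k-1<k (<-trans k-1<k k<n)) ⟩
        suc w + pred k    ≡⟨ +-suc w (pred k) ⟨
        w + suc (pred k)  ≡⟨ cong (w +_) (suc-pred k) ⟩
        w + k             ≡⟨ +-comm w k ⟩
        k + w             ≡⟨ cong (k +_) Ym≡w ⟨
        X 1 + Y m         ∎)

    -- the set of Y-values is a union of blocks [q k, q k + k): membership is constant inside a block
    record BlockRegular (v : ℕ) : Set where
      field
        X-value-divisible : ∀ {i} → i < n → X i ≡ v → k ∣ v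
        block-interior    : k ∤ v → ∀ {w} → suc w ≡ v → w ∈Y ⇔ v ∈Y

    open BlockRegular

    private
      module Interior (w : ℕ) (k∤w+1 : k ∤ suc w) (w+1<n*n : suc w < n * n)
                      (ih : ∀ {u} → u < suc w → u < n * n → BlockRegular u) where

        w<n*n : w < n * n
        w<n*n = <-trans (n<1+n w) w+1<n*n

        X-divisible : ∀ {i} → i < n → X i ≤ w → k ∣ X i
        X-divisible i<n Xi≤w = X-value-divisible (ih (s≤s Xi≤w) (≤-<-trans Xi≤w w<n*n)) i<n refl

        interior : ∀ {u} → k ∤ suc u → suc u ≤ w → u ∈Y ⇔ suc u ∈Y
        interior k∤u+1 u+1≤w = block-interior (ih (s≤s u+1≤w) (≤-<-trans u+1≤w w<n*n)) k∤u+1 refl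

        -- the X-summand of a decomposition of w is a multiple of k, so its Y-summand can be moved up by one
        w∈Y⊎shifted : w ∈Y ⊎ ∃₂ λ i u → 0 < i × i < n × suc u ∈Y × X i + suc u ≡ suc w
        w∈Y⊎shifted with ∈Y⊎positive-sum w<n*n
        ... | inj₁ w∈Y = inj₁ w∈Y
        ... | inj₂ (i , j , 0<i , i<n , j<n , e) =
          inj₂ (i , Y j , 0<i , i<n , Equivalence.to (interior k∤Yj+1 Yj+1≤w) (j , j<n , refl) , Xi+Yj+1≡w+1)
          where
          Xi+Yj+1≡w+1 : X i + suc (Y j) ≡ suc w
          Xi+Yj+1≡w+1 = trans (+-suc (X i) (Y j)) (cong suc e)

          k∤Yj+1 : k ∤ suc (Y j)
          k∤Yj+1 k∣Yj+1 = k∤w+1 (subst (k ∣_) Xi+Yj+1≡w+1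
            (∣m∣n⇒∣m+n (X-divisible i<n (subst (X i ≤_) e (m≤m+n (X i) (Y j)))) k∣Yj+1))

          Yj+1≤w : suc (Y j) ≤ w
          Yj+1≤w = subst (suc (Y j) ≤_) e (+-monoˡ-≤ (Y j) (1≤X 0<i i<n))

        no-X-value : ∀ {i} → i < n → X i ≢ suc w
        no-X-value {i} i<n Xi≡w+1 with w∈Y⊎shifted
        ... | inj₁ w∈Y = k∤w+1 (subst (k ∣_) (sym (X-after-Y⇒k w∈Y i<n Xi≡w+1)) ∣-refl)
        ... | inj₂ (a , u , _ , a<n , (c , c<n , Yc≡u+1) , e) = m+1+n≢m (X a) (begin
          X a + suc u  ≡⟨ e ⟩
          suc w        ≡⟨ Xi≡w+1 ⟨
          X i          ≡⟨ cong X a≡i ⟨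
          X a          ∎)
          where
          open ≡-Reasoning
          a≡i : a ≡ i
          a≡i = sum-injectiveˡ a<n c<n i<n (n>0 a<n) (begin
            X a + Y c        ≡⟨ cong (X a +_) Yc≡u+1 ⟩
            X a + suc u      ≡⟨ e ⟩
            suc w            ≡⟨ Xi≡w+1 ⟨
            X i              ≡⟨ +-identityʳ (X i) ⟨
            X i + 0          ≡⟨ cong (X i +_) Y-zero ⟨
            X i + Y 0        ∎)

        w+1∈Y⇒w∈Y : suc w ∈Y → w ∈Y
        w+1∈Y⇒w∈Y w+1∈Y with w∈Y⊎shifted
        ... | inj₁ w∈Y = w∈Y
        ... | inj₂ (i , u , 0<i , i<n , u+1∈Y , e) =
          contradiction (X+∈Y⇒zero i<n u+1∈Y (subst _∈Y (sym e) w+1∈Y)) (>⇒≢ 0<i)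

        w∈Y⇒w+1∈Y : w ∈Y → suc w ∈Y
        w∈Y⇒w+1∈Y w∈Y with ∈Y⊎positive-sum w+1<n*n
        ... | inj₁ w+1∈Y = w+1∈Y
        ... | inj₂ (i , j , 0<i , i<n , j<n , e) with m≤n⇒m<n∨m≡n (subst (X i ≤_) e (m≤m+n (X i) (Y j)))
        ...   | inj₂ Xi≡w+1 = contradiction Xi≡w+1 (no-X-value i<n)
        ...   | inj₁ Xi<w+1 = ⊥-elim (no-pred-decomposition (Y j) (j , j<n , refl) e)
          where
          k∣Xi : k ∣ X i
          k∣Xi = X-divisible i<n (s≤s⁻¹ Xi<w+1)

          no-pred-decomposition : ∀ v → v ∈Y → X i + v ≡ suc w → ⊥
          no-pred-decomposition zero    _   e′ = k∤w+1 (subst (k ∣_) (trans (sym (+-identityʳ (X i))) e′) k∣Xi)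
          no-pred-decomposition (suc u) u+1∈Y e′ =
            >⇒≢ 0<i (X+∈Y⇒zero i<n u∈Y (subst _∈Y (sym Xi+u≡w) w∈Y))
            where
            Xi+u≡w : X i + u ≡ w
            Xi+u≡w = suc-injective (trans (sym (+-suc (X i) u)) e′)

            k∤u+1 : k ∤ suc u
            k∤u+1 k∣u+1 = k∤w+1 (subst (k ∣_) e′ (∣m∣n⇒∣m+n k∣Xi k∣u+1))

            u∈Y : u ∈Y
            u∈Y = Equivalence.from (interior k∤u+1 (subst (suc u ≤_) Xi+u≡w (+-monoˡ-≤ u (1≤X 0<i i<n))))
                    u+1∈Y

        regular : BlockRegular (suc w)
        regular = record
          { X-value-divisible = λ i<n Xi≡w+1 → contradiction Xi≡w+1 (no-X-value i<n)
          ; block-interior    = λ { _ refl → mk⇔ w∈Y⇒w+1∈Y w+1∈Y⇒w∈Y }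
          }

    block-regular : ∀ v → v < n * n → BlockRegular v
    block-regular = <-rec (λ v → v < n * n → BlockRegular v) step
      where
      step : ∀ v → (∀ {u} → u < v → u < n * n → BlockRegular u) → v < n * n → BlockRegular v
      step v ih v<n*n with k ∣? v
      step v       ih v<n*n | yes k∣v = record
        { X-value-divisible = λ _ _ → k∣v ; block-interior = λ k∤v → contradiction k∣v k∤v }
      step zero    ih v<n*n | no  k∤0 = contradiction (k ∣0) k∤0
      step (suc w) ih v<n*n | no  k∤w+1 = Interior.regular w k∤w+1 v<n*n ih

    Y-succ-in-block : ∀ {u} → u ∈Y → k ∤ suc u → suc u < n * n → suc u ∈Y
    Y-succ-in-block u∈Y k∤u+1 u+1<n*n =
      Equivalence.to (block-interior (block-regular _ u+1<n*n) k∤u+1 refl) u∈Y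

    Y-pred-in-block : ∀ {u} → suc u ∈Y → k ∤ suc u → u ∈Y
    Y-pred-in-block u+1∈Y@(j , j<n , Yj≡u+1) k∤u+1 = Equivalence.from
      (block-interior (block-regular _ (subst (_< n * n) Yj≡u+1 (Y-bounded j<n))) k∤u+1 refl) u+1∈Y

    no-Y-between : ∀ {j u} → suc j < n → Y j < u → u < Y (suc j) → ¬ u ∈Y
    no-Y-between {j} j+1<n Yj<u u<Yj+1 (m , m<n , Ym≡u) = <⇒≱ j<m (s≤s⁻¹ m<j+1)
      where
      j<m : j < m
      j<m = Y-cancel-< (<-trans (n<1+n j) j+1<n) (subst (Y j <_) (sym Ym≡u) Yj<u)

      m<j+1 : m < suc j
      m<j+1 = Y-cancel-< m<n (subst (_< Y (suc j)) (sym Ym≡u) u<Yj+1)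

    Y-next : ∀ {j} → suc j < n → suc (Y j) ∈Y → Y (suc j) ≡ suc (Y j)
    Y-next {j} j+1<n Yj+1∈Y = ≤-antisym
      (≮⇒≥ λ Yj+1<Y[j+1] → no-Y-between j+1<n (n<1+n (Y j)) Yj+1<Y[j+1] Yj+1∈Y)
      (Y-strictMono (n<1+n j) j+1<n)

    Y-boundary-after : ∀ {j} → suc j < n → k ∣ suc (Y j) → k ∣ Y (suc j)
    Y-boundary-after {j} j+1<n k∣Yj+1 = boundary (Y (suc j)) refl
      where
      boundary : ∀ v → Y (suc j) ≡ v → k ∣ v
      boundary zero    _        = k ∣0
      boundary (suc u) Y[j+1]≡u+1 with k ∣? suc u
      ... | yes k∣u+1 = k∣u+1
      ... | no  k∤u+1 = contradiction (Y-pred-in-block (suc j , j+1<n , Y[j+1]≡u+1) k∤u+1)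
                          (no-Y-between j+1<n Yj<u (subst (u <_) (sym Y[j+1]≡u+1) (n<1+n u)))
        where
        Yj≤u : Y j ≤ u
        Yj≤u = s≤s⁻¹ (subst (Y j <_) Y[j+1]≡u+1 (Y-strictMono (n<1+n j) j+1<n))

        Yj<u : Y j < u
        Yj<u with m≤n⇒m<n∨m≡n Yj≤u
        ... | inj₁ Yj<u  = Yj<u
        ... | inj₂ refl = contradiction k∣Yj+1 k∤u+1

    Y-%-k : ∀ {j} → j < n → Y j % k ≡ j % k
    Y-%-k {zero}  _     = cong (_% k) Y-zero
    Y-%-k {suc j} j+1<n with k ∣? suc (Y j)
    ... | no k∤Yj+1 = begin
      Y (suc j) % k  ≡⟨ cong (_% k) (Y-next j+1<n Yj+1∈Y) ⟩
      suc (Y j) % k  ≡⟨ %-suc-cong (Y j) j k IH ⟩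
      suc j % k      ∎
      where
      open ≡-Reasoning
      IH : Y j % k ≡ j % k
      IH = Y-%-k (<-trans (n<1+n j) j+1<n)

      Yj+1∈Y : suc (Y j) ∈Y
      Yj+1∈Y = Y-succ-in-block (j , <-trans (n<1+n j) j+1<n , refl) k∤Yj+1
                 (≤-<-trans (Y-strictMono (n<1+n j) j+1<n) (Y-bounded j+1<n))
    ... | yes k∣Yj+1 = begin
      Y (suc j) % k  ≡⟨ n∣m⇒m%n≡0 _ k (Y-boundary-after j+1<n k∣Yj+1) ⟩
      0              ≡⟨ n∣m⇒m%n≡0 _ k k∣Yj+1 ⟨
      suc (Y j) % k  ≡⟨ %-suc-cong (Y j) j k (Y-%-k (<-trans (n<1+n j) j+1<n)) ⟩
      suc j % k      ∎
      where open ≡-Reasoning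

    Y-boundary-last : ∀ {j} → suc j ≡ n → k ∣ suc (Y j)
    Y-boundary-last {j} j+1≡n with k ∣? suc (Y j)
    ... | yes k∣Yj+1 = k∣Yj+1
    ... | no  k∤Yj+1 = contradiction (Y-succ-in-block (j , j<n , refl) k∤Yj+1 Yj+1<n*n) no-larger-Y
      where
      j<n : j < n
      j<n = ≤-reflexive j+1≡n

      Yj+1<n*n : suc (Y j) < n * n
      Yj+1<n*n = ≤-<-trans (+-monoˡ-≤ (Y j) 0<k) (sum-bounded 1<n j<n)

      no-larger-Y : ¬ suc (Y j) ∈Y
      no-larger-Y (m , m<n , Ym≡Yj+1) =
        <⇒≱ (Y-cancel-< j<n (subst (Y j <_) (sym Ym≡Yj+1) (n<1+n (Y j)))) (s≤s⁻¹ (subst (m <_) (sym j+1≡n) m<n))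

    k∣n : k ∣ n
    k∣n = m%n≡0⇒n∣m n k (begin
      n % k                  ≡⟨ cong (_% k) (suc-pred n) ⟨
      suc (pred n) % k       ≡⟨ %-suc-cong (Y (pred n)) (pred n) k (Y-%-k (≤-reflexive (suc-pred n))) ⟨
      suc (Y (pred n)) % k   ≡⟨ n∣m⇒m%n≡0 _ k (Y-boundary-last (suc-pred n)) ⟩
      0                      ∎)
      where
      open ≡-Reasoning
      instance
        n≢0 : NonZero n
        n≢0 = >-nonZero (<-trans z<s 1<n)

  2≤k : Y 1 ≡ 1 → 1 < n → 2 ≤ k
  2≤k Y1≡1 1<n with m≤n⇒m<n∨m≡n (subst (_< k) X-zero (X-strictMono z<s 1<n))
  ... | inj₁ 1<k = 1<k
  ... | inj₂ 1≡k = contradiction (sum-injectiveˡ 1<n (<-trans z<s 1<n) (<-trans z<s 1<n) 1<n (begin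
    X 1 + Y 0  ≡⟨ cong₂ _+_ (sym 1≡k) Y-zero ⟩
    1          ≡⟨ cong₂ _+_ X-zero Y1≡1 ⟨
    X 0 + Y 1  ∎)) λ ()
    where open ≡-Reasoning

columnOffset : (n a : ℕ) .{{_ : NonZero a}} → ℕ → ℕ
columnOffset n a j = j % a + a * n * (j / a)

blockSquare : (n a : ℕ) .{{_ : NonZero a}} → Matrix n
blockSquare n a p q = suc (a * toℕ p + columnOffset n a (toℕ q))

columnOffset-< : ∀ n {a j} .{{_ : NonZero a}} → j < a → columnOffset n a j ≡ j
columnOffset-< n {a} {j} j<a = begin
  j % a + a * n * (j / a)  ≡⟨ cong₂ (λ r q → r + a * n * q) (m<n⇒m%n≡m j<a) (m<n⇒m/n≡0 j<a) ⟩
  j + a * n * 0            ≡⟨ cong (j +_) (*-zeroʳ (a * n)) ⟩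
  j + 0                    ≡⟨ +-identityʳ j ⟩
  j                        ∎
  where open ≡-Reasoning

columnOffset-self : ∀ n a .{{_ : NonZero a}} → columnOffset n a a ≡ a * n
columnOffset-self n a = begin
  a % a + a * n * (a / a)  ≡⟨ cong₂ (λ r q → r + a * n * q) (n%n≡0 a) (n/n≡1 a) ⟩
  a * n * 1                ≡⟨ *-identityʳ (a * n) ⟩
  a * n                    ∎
  where open ≡-Reasoning

module _ {n a b : ℕ} .{{_ : NonZero n}} .{{_ : NonZero a}} (n≡ab : n ≡ a * b) where
  private
    instance
      b≢0 : NonZero b
      b≢0 = ≢-nonZero λ b≡0 → ≢-nonZero⁻¹ n (trans n≡ab (trans (cong (a *_) b≡0) (*-zeroʳ a)))

    y : ℕ → ℕ
    y = columnOffset n a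

    n≡ba : n ≡ b * a
    n≡ba = trans n≡ab (*-comm a b)

    quotient<b : ∀ {j} → j < n → j / a < b
    quotient<b j<n = m<n*o⇒m/o<n (subst (_ <_) n≡ba j<n)

    m<n⇒∃[o]m+o≡pred[n] : ∀ {m c} .{{_ : NonZero c}} → m < c → ∃ λ o → m + o ≡ pred c
    m<n⇒∃[o]m+o≡pred[n] {c = c} m<c = m≤n⇒∃[o]m+o≡n (s≤s⁻¹ (subst (_ <_) (sym (suc-pred c)) m<c))

  columnOffset-digits : ∀ {r} q → r < a → y (r + q * a) ≡ r + a * n * q
  columnOffset-digits {r} q r<a = cong₂ (λ r′ q′ → r′ + a * n * q′) remainder quotient-digit
    where
    remainder : (r + q * a) % a ≡ r
    remainder = trans ([m+kn]%n≡m%n r q a) (m<n⇒m%n≡m r<a)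

    quotient-digit : (r + q * a) / a ≡ q
    quotient-digit = begin
      (r + q * a) / a      ≡⟨ +-distrib-/-∣ʳ r (n∣m*n q) ⟩
      r / a + q * a / a    ≡⟨ cong₂ _+_ (m<n⇒m/n≡0 r<a) (m*n/n≡m q a) ⟩
      q                    ∎
      where open ≡-Reasoning

  -- writing j = r + q a, its mirror image n - 1 - j has digits a - 1 - r and b - 1 - q
  columnOffset-mirror : ∀ {j} → j < n → y j + y (n ∸ suc j) ≡ pred a + a * n * pred b
  columnOffset-mirror {j} j<n with m<n⇒∃[o]m+o≡pred[n] (m%n<n j a) | m<n⇒∃[o]m+o≡pred[n] (quotient<b j<n)
  ... | r′ , r+r′≡a-1 | q′ , q+q′≡b-1 = begin
    y j + y (n ∸ suc j)
      ≡⟨ cong (λ i → y i + y (n ∸ suc i)) (m≡m%n+[m/n]*n j a) ⟩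
    y (r + q * a) + y (n ∸ suc (r + q * a))
      ≡⟨ cong (λ i → y (r + q * a) + y i) mirror-digits ⟩
    y (r + q * a) + y (r′ + q′ * a)
      ≡⟨ cong₂ _+_ (columnOffset-digits q (m%n<n j a)) (columnOffset-digits q′ r′<a) ⟩
    (r + a * n * q) + (r′ + a * n * q′)
      ≡⟨ regroup r q r′ q′ (a * n) ⟩
    (r + r′) + a * n * (q + q′)
      ≡⟨ cong₂ (λ s t → s + a * n * t) r+r′≡a-1 q+q′≡b-1 ⟩
    pred a + a * n * pred b
      ∎
    where
    open ≡-Reasoning
    r q : ℕ
    r = j % a
    q = j / a

    regroup : ∀ r q r′ q′ c → (r + c * q) + (r′ + c * q′) ≡ (r + r′) + c * (q + q′)
    regroup = solve-∀

    r′<a : r′ < a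
    r′<a = subst (r′ <_) (suc-pred a) (s≤s (subst (r′ ≤_) r+r′≡a-1 (m≤n+m r′ r)))

    mirror-digits : n ∸ suc (r + q * a) ≡ r′ + q′ * a
    mirror-digits = trans (cong (_∸ suc (r + q * a)) (sym sum≡n)) (m+n∸m≡n (suc (r + q * a)) _)
      where
      regroup′ : ∀ r q r′ q′ a → suc (r + q * a) + (r′ + q′ * a) ≡ suc (r + r′) + (q + q′) * a
      regroup′ = solve-∀

      sum≡n : suc (r + q * a) + (r′ + q′ * a) ≡ n
      sum≡n = begin
        suc (r + q * a) + (r′ + q′ * a)  ≡⟨ regroup′ r q r′ q′ a ⟩
        suc (r + r′) + (q + q′) * a      ≡⟨ cong₂ (λ s t → suc s + t * a) r+r′≡a-1 q+q′≡b-1 ⟩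
        suc (pred a) + pred b * a        ≡⟨ cong (_+ pred b * a) (suc-pred a) ⟩
        suc (pred b) * a                 ≡⟨ cong (_* a) (suc-pred b) ⟩
        b * a                            ≡⟨ n≡ba ⟨
        n                                ∎

  columnOffset-strictMono : ∀ {j j′} → j < j′ → y j < y j′
  columnOffset-strictMono {j} {j′} j<j′ with m≤n⇒m<n∨m≡n (/-monoˡ-≤ a (<⇒≤ j<j′))
  ... | inj₁ q<q′ = begin-strict
    j % a + a * n * (j / a)    <⟨ +-monoˡ-< (a * n * (j / a)) (m%n<n j a) ⟩
    a + a * n * (j / a)        ≤⟨ +-monoˡ-≤ (a * n * (j / a)) (m≤m*n a n) ⟩
    a * n + a * n * (j / a)    ≡⟨ *-suc (a * n) (j / a) ⟨
    a * n * suc (j / a)        ≤⟨ *-monoʳ-≤ (a * n) q<q′ ⟩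
    a * n * (j′ / a)           ≤⟨ m≤n+m (a * n * (j′ / a)) (j′ % a) ⟩
    j′ % a + a * n * (j′ / a)  ∎
    where open ≤-Reasoning
  ... | inj₂ q≡q′ = subst (λ t → j % a + a * n * t < y j′) (sym q≡q′) (+-monoˡ-< (a * n * (j′ / a)) r<r′)
    where
    r<r′ : j % a < j′ % a
    r<r′ = +-cancelʳ-< (j′ / a * a) (j % a) (j′ % a)
      (subst₂ _<_ (trans (m≡m%n+[m/n]*n j a) (cong (λ t → j % a + t * a) q≡q′)) (m≡m%n+[m/n]*n j′ a) j<j′)

  blockSquare-bounded : ∀ {i j} → i < n → j < n → a * i + y j < n * n
  blockSquare-bounded {i} {j} i<n j<n = begin-strict
    a * i + (j % a + a * n * (j / a))  ≡⟨ +-assoc (a * i) _ _ ⟨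
    a * i + j % a + a * n * (j / a)    <⟨ +-monoˡ-< (a * n * (j / a)) row-part ⟩
    a * n + a * n * (j / a)            ≡⟨ *-suc (a * n) (j / a) ⟨
    a * n * suc (j / a)                ≤⟨ *-monoʳ-≤ (a * n) (quotient<b j<n) ⟩
    a * n * b                          ≡⟨ *-assoc a n b ⟩
    a * (n * b)                        ≡⟨ cong (a *_) (*-comm n b) ⟩
    a * (b * n)                        ≡⟨ *-assoc a b n ⟨
    a * b * n                          ≡⟨ cong (_* n) n≡ab ⟨
    n * n                              ∎
    where
    open ≤-Reasoning
    row-part : a * i + j % a < a * n
    row-part = begin-strict
      a * i + j % a  <⟨ +-monoʳ-< (a * i) (m%n<n j a) ⟩
      a * i + a      ≡⟨ +-comm (a * i) a ⟩
      a + a * i      ≡⟨ *-suc a i ⟨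
      a * suc i      ≤⟨ *-monoʳ-≤ a i<n ⟩
      a * n          ∎

  -- v = r + a u with r = v mod a, and u = i + n q is split into the row i and the column block q
  blockSquare-surjective : ∀ {v} → v < n * n → ∃₂ λ i j → i < n × j < n × a * i + y j ≡ v
  blockSquare-surjective {v} v<n*n = i , r + q * a , m%n<n u n , j<n , decomposition
    where
    r u i q : ℕ
    r = v % a
    u = v / a
    i = u % n
    q = u / n

    regroup : ∀ i r q a n → a * i + (r + a * n * q) ≡ r + (i + q * n) * a
    regroup = solve-∀

    decomposition : a * i + y (r + q * a) ≡ v
    decomposition = begin
      a * i + y (r + q * a)      ≡⟨ cong (a * i +_) (columnOffset-digits q (m%n<n v a)) ⟩
      a * i + (r + a * n * q)    ≡⟨ regroup i r q a n ⟩
      r + (i + q * n) * a        ≡⟨ cong (λ t → r + t * a) (m≡m%n+[m/n]*n u n) ⟨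
      r + u * a                  ≡⟨ m≡m%n+[m/n]*n v a ⟨
      v                          ∎
      where open ≡-Reasoning

    shuffle : ∀ n a b → n * (a * b) ≡ b * n * a
    shuffle = solve-∀

    q<b : q < b
    q<b = m<n*o⇒m/o<n (m<n*o⇒m/o<n (subst (v <_) (trans (cong (n *_) n≡ab) (shuffle n a b)) v<n*n))

    j<n : r + q * a < n
    j<n = begin-strict
      r + q * a  <⟨ +-monoˡ-< (q * a) (m%n<n v a) ⟩
      suc q * a  ≤⟨ *-monoˡ-≤ a q<b ⟩
      b * a      ≡⟨ n≡ba ⟨
      n          ∎
      where open ≤-Reasoning

  blockSquare-first-row : ∀ {j} → j < n → blockSquare n a (0 mod n) (j mod n) ≡ suc (y j)
  blockSquare-first-row {j} j<n = cong suc (begin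
    a * toℕ (0 mod n) + y (toℕ (j mod n))
      ≡⟨ cong₂ (λ s t → a * s + y t) (toℕ-mod (≤-<-trans z≤n j<n)) (toℕ-mod j<n) ⟩
    a * 0 + y j                            ≡⟨ cong (_+ y j) (*-zeroʳ a) ⟩
    y j                                    ∎)
    where open ≡-Reasoning

  private
    M : Matrix n
    M = blockSquare n a

    pair-sum : ∀ x u v → suc (x + u) + suc (x + v) ≡ suc (suc (x + x + (u + v)))
    pair-sum = solve-∀

    pair-sum′ : ∀ u v w → suc (u + w) + suc (v + w) ≡ suc (suc ((u + v) + (w + w)))
    pair-sum′ = solve-∀

    exchange : ∀ s t u v → suc (s + t) + suc (u + v) ≡ suc (s + v) + suc (u + t)
    exchange = solve-∀

  blockSquare-row-mirror : ∀ i j → M i j + M i (opposite j)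
                                   ≡ suc (suc (a * toℕ i + a * toℕ i + (pred a + a * n * pred b)))
  blockSquare-row-mirror i j = begin
    M i j + M i (opposite j)
      ≡⟨ cong (λ t → M i j + suc (a * toℕ i + y t)) (opposite-prop j) ⟩
    M i j + suc (a * toℕ i + y (n ∸ suc (toℕ j)))
      ≡⟨ pair-sum (a * toℕ i) (y (toℕ j)) _ ⟩
    suc (suc (a * toℕ i + a * toℕ i + (y (toℕ j) + y (n ∸ suc (toℕ j)))))
      ≡⟨ cong (λ t → suc (suc (a * toℕ i + a * toℕ i + t))) (columnOffset-mirror (toℕ<n j)) ⟩
    suc (suc (a * toℕ i + a * toℕ i + (pred a + a * n * pred b)))
      ∎
    where open ≡-Reasoning

  blockSquare-column-mirror : ∀ i j → M i j + M (opposite i) j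
                                      ≡ suc (suc (a * pred n + (y (toℕ j) + y (toℕ j))))
  blockSquare-column-mirror i j = begin
    M i j + M (opposite i) j
      ≡⟨ pair-sum′ (a * toℕ i) (a * toℕ (opposite i)) (y (toℕ j)) ⟩
    suc (suc (a * toℕ i + a * toℕ (opposite i) + (y (toℕ j) + y (toℕ j))))
      ≡⟨ cong (λ t → suc (suc (t + (y (toℕ j) + y (toℕ j))))) rows ⟩
    suc (suc (a * pred n + (y (toℕ j) + y (toℕ j))))
      ∎
    where
    open ≡-Reasoning
    rows : a * toℕ i + a * toℕ (opposite i) ≡ a * pred n
    rows = begin
      a * toℕ i + a * toℕ (opposite i)  ≡⟨ *-distribˡ-+ a (toℕ i) _ ⟨
      a * (toℕ i + toℕ (opposite i))    ≡⟨ cong (λ t → a * (toℕ i + t)) (opposite-prop i) ⟩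
      a * (toℕ i + (n ∸ suc (toℕ i)))   ≡⟨ cong (a *_) (cong pred (m+[n∸m]≡n (toℕ<n i))) ⟩
      a * pred n                        ∎

  blockSquare-entries : EntriesAre1toN² M
  blockSquare-entries = (λ p q → s≤s z≤n , blockSquare-bounded (toℕ<n p) (toℕ<n q)) , hit
    where
    hit : ∀ m → 1 ≤ m → m ≤ n * n → ∃₂ λ p q → M p q ≡ m
    hit (suc v) _ v<n*n with blockSquare-surjective v<n*n
    ... | i , j , i<n , j<n , e = fromℕ< i<n , fromℕ< j<n ,
      cong suc (trans (cong₂ (λ s t → a * s + y t) (toℕ-fromℕ< i<n) (toℕ-fromℕ< j<n)) e)

  blockSquare-isPRS : 1 < a → IsPrincipalReversibleSquare n M
  blockSquare-isPRS 1<a = (isR , isV) , blockSquare-entries , increasing , corner , next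
    where
    isR : IsR M
    isR = (λ i j l → trans (blockSquare-row-mirror i j) (sym (blockSquare-row-mirror i l)))
        , (λ i j l → trans (blockSquare-column-mirror i j) (sym (blockSquare-column-mirror l j)))

    isV : IsV M
    isV i j l m = exchange (a * toℕ i) (y (toℕ j)) (a * toℕ l) (y (toℕ m))

    increasing : Increasing M
    increasing = (λ i j l j<l → s≤s (+-monoʳ-< (a * toℕ i) (columnOffset-strictMono j<l)))
               , (λ i j l i<l → s≤s (+-monoˡ-< (y (toℕ j)) (*-monoʳ-< a i<l)))

    1<n : 1 < n
    1<n = subst (1 <_) (sym n≡ab) (<-≤-trans 1<a (m≤m*n a b))

    corner : M (0 mod n) (0 mod n) ≡ 1
    corner = trans (blockSquare-first-row (<-trans z<s 1<n)) (cong suc (columnOffset-< n (<-trans z<s 1<a)))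

    next : M (0 mod n) (1 mod n) ≡ 2
    next = trans (blockSquare-first-row 1<n) (cong suc (columnOffset-< n 1<a))

-- counting: n² entries take all n² values, so they are pairwise distinct
entries-injective : ∀ {n} {M : Matrix n} → EntriesAre1toN² M →
                    ∀ {p q p′ q′} → M p q ≡ M p′ q′ → p ≡ p′ × q ≡ q′
entries-injective {n} {M} (in-range , hit) {p} {q} {p′} {q′} Mpq≡Mp′q′ =
  combine-injective p q p′ q′ (surjective⇒injective surjective (toℕ-injective (begin
    toℕ (f (combine p q))    ≡⟨ toℕ-f p q ⟩
    pred (M p q)             ≡⟨ cong pred Mpq≡Mp′q′ ⟩
    pred (M p′ q′)           ≡⟨ toℕ-f p′ q′ ⟨
    toℕ (f (combine p′ q′))  ∎)))
  where
  open ≡-Reasoning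
  pred-entry< : ∀ p q → pred (M p q) < n * n
  pred-entry< p q with M p q | in-range p q
  ... | suc m | _ , m<n*n = m<n*n

  f : Fin (n * n) → Fin (n * n)
  f c = fromℕ< (uncurry pred-entry< (remQuot n c))

  toℕ-f : ∀ p q → toℕ (f (combine p q)) ≡ pred (M p q)
  toℕ-f p q = trans (toℕ-fromℕ< _) (cong (uncurry λ p q → pred (M p q)) (remQuot-combine p q))

  surjective : ∀ t → ∃ λ c → f c ≡ t
  surjective t with hit (suc (toℕ t)) (s≤s z≤n) (toℕ<n t)
  ... | p , q , Mpq≡t+1 = combine p q , toℕ-injective (trans (toℕ-f p q) (cong pred Mpq≡t+1))

firstColumn firstRow : ∀ {n} .{{_ : NonZero n}} → Matrix n → ℕ → ℕ
firstColumn {n} M i = pred (M (i mod n) (0 mod n))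
firstRow    {n} M j = pred (M (0 mod n) (j mod n))

module _ {n : ℕ} .{{_ : NonZero n}} {M : Matrix n} (isPRS : IsPrincipalReversibleSquare n M) where
  private
    X Y : ℕ → ℕ
    X = firstColumn M
    Y = firstRow M

    z : Fin n
    z = 0 mod n

    isV : IsV M
    isV = proj₂ (proj₁ isPRS)

    in-range : ∀ p q → 1 ≤ M p q × M p q ≤ n * n
    in-range = proj₁ (proj₁ (proj₂ isPRS))

    hit : ∀ m → 1 ≤ m → m ≤ n * n → ∃₂ λ p q → M p q ≡ m
    hit = proj₂ (proj₁ (proj₂ isPRS))

    increasing : Increasing M
    increasing = proj₁ (proj₂ (proj₂ isPRS))

    corner : M z z ≡ 1
    corner = proj₁ (proj₂ (proj₂ (proj₂ isPRS)))

    entry≢0 : ∀ p q → NonZero (M p q)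
    entry≢0 p q = >-nonZero (proj₁ (in-range p q))

    mod-toℕ : ∀ (p : Fin n) → toℕ p mod n ≡ p
    mod-toℕ p = toℕ-injective (toℕ-mod (toℕ<n p))

  -- condition (V) with k = l = 0 splits each entry into its first-column and first-row parts
  PRS-entry : ∀ p q → M p q ≡ suc (X (toℕ p) + Y (toℕ q))
  PRS-entry p q = suc-injective (begin
    suc (M p q)    ≡⟨ +-comm 1 (M p q) ⟩
    M p q + 1      ≡⟨ cong (M p q +_) corner ⟨
    M p q + M z z  ≡⟨ isV p q z z ⟩
    M p z + M z q
      ≡⟨ cong₂ _+_ (suc-pred _ {{entry≢0 p z}}) (suc-pred _ {{entry≢0 z q}}) ⟨
    suc (pred (M p z)) + suc (pred (M z q))
      ≡⟨ cong₂ (λ s t → suc (pred (M s z)) + suc (pred (M z t))) (mod-toℕ p) (mod-toℕ q) ⟨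
    suc (X (toℕ p)) + suc (Y (toℕ q))
      ≡⟨ cong suc (+-suc _ _) ⟩
    suc (suc (X (toℕ p) + Y (toℕ q)))
      ∎)
    where open ≡-Reasoning

  private
    PRS-entry-ℕ : ∀ {i j} → i < n → j < n → M (i mod n) (j mod n) ≡ suc (X i + Y j)
    PRS-entry-ℕ i<n j<n = trans (PRS-entry _ _) (cong₂ (λ s t → suc (X s + Y t)) (toℕ-mod i<n) (toℕ-mod j<n))

    pred-mono-entry : ∀ {p q p′ q′} → M p q < M p′ q′ → pred (M p q) < pred (M p′ q′)
    pred-mono-entry {p} {q} = pred-mono-< {{entry≢0 p q}}

    mod-mono : ∀ {i j} → i < j → j < n → toℕ (i mod n) < toℕ (j mod n)
    mod-mono i<j j<n = subst₂ _<_ (sym (toℕ-mod (<-trans i<j j<n))) (sym (toℕ-mod j<n)) i<j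

  PRS-sumTiling : IsSumTiling n X Y
  PRS-sumTiling = record
    { X-zero         = cong pred corner
    ; Y-zero         = cong pred corner
    ; X-strictMono   = λ i<j j<n → pred-mono-entry (proj₂ increasing _ z _ (mod-mono i<j j<n))
    ; Y-strictMono   = λ i<j j<n → pred-mono-entry (proj₁ increasing z _ _ (mod-mono i<j j<n))
    ; sum-injectiveˡ = sum-injectiveˡ
    ; sum-surjective = λ {v} → sum-surjective v
    ; sum-bounded    = λ i<n j<n → subst (_≤ n * n) (PRS-entry-ℕ i<n j<n) (proj₂ (in-range _ _))
    }
    where
    sum-injectiveˡ : ∀ {i j i′ j′} → i < n → j < n → i′ < n → j′ < n →
                     X i + Y j ≡ X i′ + Y j′ → i ≡ i′
    sum-injectiveˡ {i} {j} {i′} {j′} i<n j<n i′<n j′<n e = begin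
      i                  ≡⟨ toℕ-mod i<n ⟨
      toℕ (i mod n)      ≡⟨ cong toℕ (proj₁ (entries-injective (proj₁ (proj₂ isPRS)) same-entry)) ⟩
      toℕ (i′ mod n)     ≡⟨ toℕ-mod i′<n ⟩
      i′                 ∎
      where
      open ≡-Reasoning
      same-entry : M (i mod n) (j mod n) ≡ M (i′ mod n) (j′ mod n)
      same-entry = trans (PRS-entry-ℕ i<n j<n) (trans (cong suc e) (sym (PRS-entry-ℕ i′<n j′<n)))

    sum-surjective : ∀ v → v < n * n → ∃₂ λ i j → i < n × j < n × X i + Y j ≡ v
    sum-surjective v v<n*n with hit (suc v) (s≤s z≤n) v<n*n
    ... | p , q , Mpq≡v+1 =
      toℕ p , toℕ q , toℕ<n p , toℕ<n q , suc-injective (trans (sym (PRS-entry p q)) Mpq≡v+1)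

  PRS-firstRow-one : Y 1 ≡ 1
  PRS-firstRow-one = cong pred (proj₂ (proj₂ (proj₂ (proj₂ isPRS))))

standard-isPRS : ∀ {n} .{{_ : NonZero n}} → 1 < n → IsPrincipalReversibleSquare n (blockSquare n n)
standard-isPRS {n} = blockSquare-isPRS (sym (*-identityʳ n))

prime⇒PRS-standard : ∀ {n} .{{_ : NonZero n}} {M} → Prime n → IsPrincipalReversibleSquare n M →
                     ∀ p q → M p q ≡ blockSquare n n p q
prime⇒PRS-standard {n} {M} n-prime isPRS p q = begin
  M p q
    ≡⟨ PRS-entry isPRS p q ⟩
  suc (firstColumn M (toℕ p) + firstRow M (toℕ q))
    ≡⟨ cong₂ (λ s t → suc (s + t)) (X-linear n≤k (toℕ<n p)) (Y-identity n≤k (toℕ<n q)) ⟩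
  suc (n * toℕ p + toℕ q)
    ≡⟨ cong (λ t → suc (n * toℕ p + t)) (columnOffset-< n (toℕ<n q)) ⟨
  blockSquare n n p q
    ∎
  where
  open ≡-Reasoning
  open SumTiling (PRS-sumTiling isPRS)

  1<n : 1 < n
  1<n = nonTrivial⇒n>1 n {{prime⇒nonTrivial n-prime}}

  n≤k : n ≤ k
  n≤k = ≮⇒≥ λ k<n → prime⇒¬composite n-prime
    (hasNonTrivialDivisor {{n>1⇒nonTrivial (2≤k (PRS-firstRow-one isPRS) 1<n)}} k<n (k∣n 1<n k<n))

prime⇒uniquePRS : ∀ {n} .{{_ : NonZero n}} → Prime n → UniquePRS n
prime⇒uniquePRS {n} n-prime =
  blockSquare n n , standard-isPRS (nonTrivial⇒n>1 n {{prime⇒nonTrivial n-prime}}) ,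
  λ M isPRS → prime⇒PRS-standard n-prime isPRS

-- a divisor d of n gives a second square, whose entry d + 1 of the standard first row becomes d n + 1
composite⇒¬uniquePRS : ∀ {n} .{{_ : NonZero n}} → Composite n → ¬ UniquePRS n
composite⇒¬uniquePRS {n} (hasNonTrivialDivisor {d} d<n (divides zero n≡0)) _ = ≢-nonZero⁻¹ n n≡0
composite⇒¬uniquePRS {n} (hasNonTrivialDivisor {d} d<n (divides (suc q) n≡[q+1]d)) (M , _ , unique) =
  contradiction (*-cancelˡ-≡ n 1 d (suc-injective (begin
    suc (d * n)                          ≡⟨ cong suc (columnOffset-self n d) ⟨
    suc (columnOffset n d d)             ≡⟨ blockSquare-first-row {a = d} n≡d[q+1] d<n ⟨
    blockSquare n d (0 mod n) (d mod n)  ≡⟨ unique _ (blockSquare-isPRS n≡d[q+1] 1<d) _ _ ⟩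
    M (0 mod n) (d mod n)                ≡⟨ unique _ (standard-isPRS 1<n) _ _ ⟨
    blockSquare n n (0 mod n) (d mod n)  ≡⟨ blockSquare-first-row {a = n} (sym (*-identityʳ n)) d<n ⟩
    suc (columnOffset n n d)             ≡⟨ cong suc (columnOffset-< n d<n) ⟩
    suc d                                ≡⟨ cong suc (*-identityʳ d) ⟨
    suc (d * 1)                          ∎))) (>⇒≢ 1<n)
  where
  open ≡-Reasoning
  instance
    d≢0 : NonZero d
    d≢0 = nonTrivial⇒nonZero d

  1<d : 1 < d
  1<d = nonTrivial⇒n>1 d

  1<n : 1 < n
  1<n = <-trans 1<d d<n

  n≡d[q+1] : n ≡ d * suc q
  n≡d[q+1] = trans n≡[q+1]d (*-comm (suc q) d)

uniquePRS⇒prime : ∀ n .{{_ : NonZero n}} → UniquePRS n → Prime n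
uniquePRS⇒prime 1      (_ , (_ , _ , _ , corner , next) , _) = contradiction (trans (sym corner) next) λ ()
uniquePRS⇒prime (2+ _) unique = prime λ composite → composite⇒¬uniquePRS composite unique

corollary27 : (n : ℕ) .{{_ : NonZero n}} → UniquePRS n ⇔ Prime n
corollary27 n = mk⇔ (uniquePRS⇒prime n) prime⇒uniquePRS
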